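{- If $p\equiv 3\pmod 4$ is a prime with $p\geq 7$, then there exists a $(4\times 24p,4\times 24,\{4,5\},1)$-BDP, i.e. a balanced $(Z_4\times Z_{24p},\{4,5\},1)$ difference packing whose difference leave is exactly $Z_4\times pZ_{24p}$.
   Context: Let $G$ be a finite additive group and $K$ a set of positive integers. For $C\subseteq G$, $\Delta C$ denotes the multiset of all differences $x-y$ with $(x,y)$ an ordered pair of distinct elements of $C$. A $(G,K,1)$ difference packing is a set $\mathcal B$ of subsets of $G$ (blocks), each of size in $K$, such that the multiset $\bigcup_{B\in\mathcal B}\Delta B$ contains every element of $G$ at most once; its difference leave is the set of elements of $G$ not occurring in this multiset. It is balanced (BDP) if the number of blocks of size $k$ is the same for every $k\in K$. For $s\mid u$ and $t\mid v$, a $(u\times v,s\times t,K,1)$-BDP is a balanced $(Z_u\times Z_v,K,1)$ difference packing whose difference leave is exactly the subgroup $(u/s)Z_u\times (v/t)Z_v$. -}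

module Defs where

open import Data.Nat using (ℕ; zero; suc; _+_; _*_; _∸_; _/_; NonZero)
open import Data.Nat.DivMod using (_mod_)
open import Data.Nat.Divisibility using (_∣_)
open import Data.Fin using (Fin; toℕ)
open import Data.Product using (_×_; _,_; proj₁; proj₂)
open import Data.List using (List; []; _∷_; length; concatMap; filter; allFin; map; lookup)
open import Data.List.Relation.Unary.All using (All)
open import Data.List.Relation.Unary.Unique.Propositional using (Unique)
open import Data.List.Membership.Propositional using (_∈_; _∉_)
open import Relation.Binary.PropositionalEquality using (_≡_; _≢_)
open import Relation.Nullary using (¬_; yes; no)
open import Data.Nat using (_≟_)
open import Function.Bundles using (_⇔_)

G : ℕ → ℕ → Set
G u v = Fin u × Fin v

subZ : (n : ℕ) → .{{_ : NonZero n}} → Fin n → Fin n → Fin n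
subZ n x y = (toℕ x + (n ∸ toℕ y)) mod n

subG : (u v : ℕ) → .{{_ : NonZero u}} → .{{_ : NonZero v}} → G u v → G u v → G u v
subG u v (a , b) (c , d) = subZ u a c , subZ v b d

-- A block is a list of pairwise distinct elements (a subset of G).
-- ΔB: the list of x - y over ordered pairs of distinct positions (i.e. distinct elements).
ΔB : (u v : ℕ) → .{{_ : NonZero u}} → .{{_ : NonZero v}} → List (G u v) → List (G u v)
ΔB u v B = concatMap (λ i → concatMap (λ j → diffAt i j) (allFin (length B))) (allFin (length B))
  where
  diffAt : Fin (length B) → Fin (length B) → List (G u v)
  diffAt i j with toℕ i ≟ toℕ j
  ... | yes _ = []
  ... | no _ = subG u v (lookup B i) (lookup B j) ∷ []

ΔFamily : (u v : ℕ) → .{{_ : NonZero u}} → .{{_ : NonZero v}} → List (List (G u v)) → List (G u v)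
ΔFamily u v ℬ = concatMap (ΔB u v) ℬ

countSize : {A : Set} → ℕ → List (List A) → ℕ
countSize k ℬ = length (filter (λ B → length B ≟ k) ℬ)

-- (u × v, s × t, K, 1)-BDP:  a balanced (Z_u × Z_v, K, 1) difference packing
-- whose difference leave is exactly (u/s)Z_u × (v/t)Z_v.
IsBDP : (u v s t : ℕ) → .{{_ : NonZero u}} → .{{_ : NonZero v}}
        → .{{_ : NonZero s}} → .{{_ : NonZero t}}
        → (K : List ℕ) → List (List (G u v)) → Set
IsBDP u v s t K ℬ =
    All (λ B → Unique B × (length B ∈ K)) ℬ
  × Unique (ΔFamily u v ℬ)
  × (∀ k k' → k ∈ K → k' ∈ K → countSize k ℬ ≡ countSize k' ℬ)
  × (∀ (g : G u v) → (g ∉ ΔFamily u v ℬ) ⇔ (((u / s) ∣ toℕ (proj₁ g)) × ((v / t) ∣ toℕ (proj₂ g))))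

-- Identify Z₂₄ₚ with Z₂₄ × Zₚ. Twelve base blocks (six of size 4, six of size 5) of points
-- ((a , b) , c) ∈ Z₄ × Z₂₄ × ℕ are translated, for each 1 ≤ s ≤ (p − 1)/2, to the blocks of
-- points (a , p b + 24 s² c) of Z₄ × Z₂₄ₚ. A difference of two such points is determined modulo 24
-- by the code (a − a' , b − b') of the base pair (as p² ≡ 1 mod 24), and modulo p by 24 s² (c − c').
-- By computation every one of the 96 codes belongs to exactly two base pairs, and their
-- c-differences e, e' satisfy e'/e ∈ {−1, −4, −¼}. Since −1 is not a square modulo p ≡ 3 (mod 4),
-- s² e ≢ s'² e' (mod p) unless the pairs and the multipliers coincide. Hence all differences are
-- distinct, and for each code the 2 · (p − 1)/2 residues 24 s² e are all the nonzero residues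
-- modulo p: the differences are exactly the elements whose Z₂₄ₚ-coordinate is prime to p.

module Submission where

module Congruence where

  open import Data.Nat as ℕ using (ℕ; zero; suc; NonZero; _<_; _≤_)
  import Data.Nat.Properties as ℕ
  open import Data.Nat.DivMod using (_mod_; m%n<n)
  open import Data.Integer as ℤ using (ℤ; +_; -_; _+_; _-_; _*_; _%ℕ_; _/ℕ_)
  import Data.Integer.Properties as ℤ
  open import Data.Integer.DivMod using (a≡a%ℕn+[a/ℕn]*n)
  open import Data.Integer.Divisibility.Signed
    using (_∣_; divides; ∣⇒∣ᵤ; ∣ᵤ⇒∣; ∣m∣n⇒∣m+n; ∣m⇒∣-m; ∣n⇒∣m*n; ∣m⇒∣m*n)
  open import Data.Integer.Tactic.RingSolver using (solve-∀)
  import Data.Nat.Divisibility as ℕ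
  open import Data.Nat.Primality using (Prime; euclidsLemma)
  open import Data.Fin using (Fin; toℕ)
  import Data.Fin.Properties as Fin
  open import Data.Sum using (inj₁; inj₂)
  open import Data.Empty using (⊥-elim)
  open import Relation.Nullary using (¬_)
  open import Relation.Binary.Bundles using (Setoid)
  open import Relation.Binary.PropositionalEquality
  open import Defs using (subZ)

  infix 4 _≡_[mod_]

  -- A record rather than a synonym for m ∣ a - b, so that a and b remain inferable.
  record _≡_[mod_] (a b m : ℤ) : Set where
    constructor ∣-difference
    field divides-difference : m ∣ a - b

  open _≡_[mod_] public

  module _ {m : ℤ} where

    ≡-mod-refl : ∀ {a} → a ≡ a [mod m ]
    ≡-mod-refl {a} = ∣-difference (divides (+ 0) (trans (ℤ.+-inverseʳ a) (sym (ℤ.*-zeroˡ m))))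

    ≡⇒≡-mod : ∀ {a b} → a ≡ b → a ≡ b [mod m ]
    ≡⇒≡-mod refl = ≡-mod-refl

    ≡-mod-sym : ∀ {a b} → a ≡ b [mod m ] → b ≡ a [mod m ]
    ≡-mod-sym {a} {b} (∣-difference d) = ∣-difference (subst (m ∣_) (negate a b) (∣m⇒∣-m d))
      where negate : ∀ a b → - (a - b) ≡ b - a
            negate = solve-∀

    ≡-mod-trans : ∀ {a b c} → a ≡ b [mod m ] → b ≡ c [mod m ] → a ≡ c [mod m ]
    ≡-mod-trans {a} {b} {c} (∣-difference d) (∣-difference e) =
      ∣-difference (subst (m ∣_) (telescope a b c) (∣m∣n⇒∣m+n d e))
      where telescope : ∀ a b c → (a - b) + (b - c) ≡ a - c
            telescope = solve-∀

    +-cong-mod : ∀ {a b c d} → a ≡ b [mod m ] → c ≡ d [mod m ] → a + c ≡ b + d [mod m ]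
    +-cong-mod {a} {b} {c} {d} (∣-difference e) (∣-difference f) =
      ∣-difference (subst (m ∣_) (regroup a b c d) (∣m∣n⇒∣m+n e f))
      where regroup : ∀ a b c d → (a - b) + (c - d) ≡ (a + c) - (b + d)
            regroup = solve-∀

    neg-cong-mod : ∀ {a b} → a ≡ b [mod m ] → - a ≡ - b [mod m ]
    neg-cong-mod {a} {b} (∣-difference d) = ∣-difference (subst (m ∣_) (regroup a b) (∣m⇒∣-m d))
      where regroup : ∀ a b → - (a - b) ≡ - a - - b
            regroup = solve-∀

    -‿cong-mod : ∀ {a b c d} → a ≡ b [mod m ] → c ≡ d [mod m ] → a - c ≡ b - d [mod m ]
    -‿cong-mod e f = +-cong-mod e (neg-cong-mod f)

    *-cong-mod : ∀ {a b c d} → a ≡ b [mod m ] → c ≡ d [mod m ] → a * c ≡ b * d [mod m ]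
    *-cong-mod {a} {b} {c} {d} (∣-difference e) (∣-difference f) =
      ∣-difference (subst (m ∣_) (regroup a b c d) (∣m∣n⇒∣m+n (∣n⇒∣m*n a f) (∣m⇒∣m*n d e)))
      where regroup : ∀ a b c d → a * (c - d) + (a - b) * d ≡ a * c - b * d
            regroup = solve-∀

    *-congˡ-mod : ∀ a {c d} → c ≡ d [mod m ] → a * c ≡ a * d [mod m ]
    *-congˡ-mod a = *-cong-mod (≡-mod-refl {a})

    *-congʳ-mod : ∀ c {a b} → a ≡ b [mod m ] → a * c ≡ b * c [mod m ]
    *-congʳ-mod c e = *-cong-mod e (≡-mod-refl {c})

    +-congˡ-mod : ∀ a {c d} → c ≡ d [mod m ] → a + c ≡ a + d [mod m ]
    +-congˡ-mod a = +-cong-mod (≡-mod-refl {a})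

    +-congʳ-mod : ∀ c {a b} → a ≡ b [mod m ] → a + c ≡ b + c [mod m ]
    +-congʳ-mod c e = +-cong-mod e (≡-mod-refl {c})

    multiple≡0-mod : ∀ k → k * m ≡ + 0 [mod m ]
    multiple≡0-mod k = ∣-difference (divides k (ℤ.+-identityʳ (k * m)))

    modulus≡0-mod : m ≡ + 0 [mod m ]
    modulus≡0-mod = subst (_≡ + 0 [mod m ]) (ℤ.*-identityˡ m) (multiple≡0-mod (+ 1))

    ∣⇒≡0-mod : ∀ {a} → m ∣ a → a ≡ + 0 [mod m ]
    ∣⇒≡0-mod {a} d = ∣-difference (subst (m ∣_) (sym (ℤ.+-identityʳ a)) d)

    ≡0-mod⇒∣ : ∀ {a} → a ≡ + 0 [mod m ] → m ∣ a
    ≡0-mod⇒∣ {a} (∣-difference d) = subst (m ∣_) (ℤ.+-identityʳ a) d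

  ≡-mod-setoid : ℤ → Setoid _ _
  ≡-mod-setoid m = record
    { Carrier = ℤ
    ; _≈_ = λ a b → a ≡ b [mod m ]
    ; isEquivalence = record { refl = ≡-mod-refl ; sym = ≡-mod-sym ; trans = ≡-mod-trans }
    }

  module ≡-mod-Reasoning (m : ℤ) where
    open import Relation.Binary.Reasoning.Setoid (≡-mod-setoid m) public

  ≡-mod-weakenˡ : ∀ {m n a b} → a ≡ b [mod m * n ] → a ≡ b [mod m ]
  ≡-mod-weakenˡ {m} {n} {a} {b} (∣-difference (divides q eq)) =
    ∣-difference (divides (q * n) (trans eq (reassoc q m n)))
    where reassoc : ∀ q m n → q * (m * n) ≡ (q * n) * m
          reassoc = solve-∀

  ≡-mod-weakenʳ : ∀ {m n a b} → a ≡ b [mod m * n ] → a ≡ b [mod n ]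
  ≡-mod-weakenʳ {m} {n} e = ≡-mod-weakenˡ (subst (λ k → _ ≡ _ [mod k ]) (ℤ.*-comm m n) e)

  ≡-mod-prime-combine : ∀ {p m a b} → Prime p → ¬ (p ℕ.∣ m) →
                        a ≡ b [mod + m ] → a ≡ b [mod + p ] → a ≡ b [mod + m * + p ]
  ≡-mod-prime-combine {p} {m} pp p∤m (∣-difference (divides t eq)) (∣-difference p∣a-b)
    with euclidsLemma ℤ.∣ t ∣ m pp (subst (p ℕ.∣_) (ℤ.abs-* t (+ m)) (∣⇒∣ᵤ (subst (+ p ∣_) eq p∣a-b)))
  ... | inj₂ p∣m = ⊥-elim (p∤m p∣m)
  ... | inj₁ p∣t with ∣ᵤ⇒∣ {+ p} {t} p∣t
  ...   | divides u refl =
    ∣-difference (divides u (trans eq (trans (ℤ.*-assoc u (+ p) (+ m)) (cong (u *_) (ℤ.*-comm (+ p) (+ m))))))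

  +-∸ : ∀ {x y} → y ≤ x → + (x ℕ.∸ y) ≡ + x - + y
  +-∸ {x} {y} y≤x = sym (trans (ℤ.m-n≡m⊖n x y) (ℤ.⊖-≥ y≤x))

  %ℕ-≡-mod : ∀ a n .{{_ : NonZero n}} → + (a %ℕ n) ≡ a [mod + n ]
  %ℕ-≡-mod a n = ∣-difference (divides (- (a /ℕ n))
    (trans (cong (λ z → + (a %ℕ n) - z) (a≡a%ℕn+[a/ℕn]*n a n)) (cancel (+ (a %ℕ n)) (a /ℕ n) (+ n))))
    where cancel : ∀ r q n → r - (r + q * n) ≡ - q * n
          cancel = solve-∀

  %-≡-mod : ∀ x n .{{_ : NonZero n}} → + (x ℕ.% n) ≡ + x [mod + n ]
  %-≡-mod x n = %ℕ-≡-mod (+ x) n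

  mod-≡-mod : ∀ x n .{{_ : NonZero n}} → + toℕ (x mod n) ≡ + x [mod + n ]
  mod-≡-mod x n = subst (_≡ + x [mod + n ]) (cong +_ (sym (Fin.toℕ-fromℕ< (m%n<n x n)))) (%-≡-mod x n)

  subZ-≡-mod : ∀ n .{{_ : NonZero n}} (x y : Fin n) → + toℕ (subZ n x y) ≡ + toℕ x - + toℕ y [mod + n ]
  subZ-≡-mod n x y = begin
    + toℕ (subZ n x y)             ≈⟨ mod-≡-mod (toℕ x ℕ.+ (n ℕ.∸ toℕ y)) n ⟩
    + (toℕ x ℕ.+ (n ℕ.∸ toℕ y))    ≡⟨ ℤ.pos-+ (toℕ x) (n ℕ.∸ toℕ y) ⟩
    + toℕ x + + (n ℕ.∸ toℕ y)      ≡⟨ cong (λ z → + toℕ x + z) (+-∸ (ℕ.<⇒≤ (Fin.toℕ<n y))) ⟩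
    + toℕ x + (+ n - + toℕ y)      ≈⟨ +-congˡ-mod (+ toℕ x) (+-congʳ-mod (- + toℕ y) modulus≡0-mod) ⟩
    + toℕ x + (+ 0 - + toℕ y)      ≡⟨ cong (λ z → + toℕ x + z) (ℤ.+-identityˡ (- + toℕ y)) ⟩
    + toℕ x - + toℕ y              ∎
    where open ≡-mod-Reasoning (+ n)

  multiple-below⇒0 : ∀ {n m} → n ℕ.∣ m → m < n → m ≡ 0
  multiple-below⇒0 {m = zero}  _   _   = refl
  multiple-below⇒0 {m = suc m} n∣m m<n = ⊥-elim (ℕ.>⇒∤ m<n n∣m)

  subZ-self-≡-mod : ∀ n .{{_ : NonZero n}} (x : Fin n) → + toℕ (subZ n x x) ≡ + 0 [mod + n ]
  subZ-self-≡-mod n x = ≡-mod-trans (subZ-≡-mod n x x) (≡⇒≡-mod (ℤ.+-inverseʳ (+ toℕ x)))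

  private
    ≡-mod∧≥⇒≡ : ∀ {n x y} → x < n → y ≤ x → + x ≡ + y [mod + n ] → x ≡ y
    ≡-mod∧≥⇒≡ {n} {x} {y} x<n y≤x (∣-difference n∣x-y) = ℕ.≤-antisym (ℕ.m∸n≡0⇒m≤n x∸y≡0) y≤x
      where
      x∸y≡0 : x ℕ.∸ y ≡ 0
      x∸y≡0 = multiple-below⇒0 (∣⇒∣ᵤ (subst (+ n ∣_) (sym (+-∸ y≤x)) n∣x-y)) (ℕ.≤-<-trans (ℕ.m∸n≤m x y) x<n)

  ≡-mod⇒≡ : ∀ {n x y} → x < n → y < n → + x ≡ + y [mod + n ] → x ≡ y
  ≡-mod⇒≡ x<n y<n e with ℕ.≤-total _ _
  ... | inj₁ y≤x = ≡-mod∧≥⇒≡ x<n y≤x e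
  ... | inj₂ x≤y = sym (≡-mod∧≥⇒≡ y<n x≤y (≡-mod-sym e))

module Counting where

  open import Data.Nat as ℕ using (ℕ; suc; _≤_; z≤n; s≤s)
  import Data.Nat.Properties as ℕ
  open import Data.List using (List; []; _∷_; length; map; filter; cartesianProductWith)
  open import Data.List.Properties using (length-removeAt′; length-map)
  open import Data.List.Relation.Unary.All as All using (All)
  open import Data.List.Relation.Unary.AllPairs using (_∷_)
  open import Data.List.Relation.Binary.Disjoint.Propositional using (Disjoint)
  open import Data.List.Relation.Unary.Any using (here; there; _─_; index)
  open import Data.List.Relation.Unary.Unique.Propositional using (Unique; [])
  import Data.List.Relation.Unary.Unique.Propositional.Properties as Unique
  open import Data.List.Relation.Binary.Subset.Propositional using (_⊆_)
  open import Data.List.Membership.Propositional using (_∈_)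
  import Data.List.Membership.Propositional.Properties as ∈
  open import Data.List.Membership.DecPropositional using () renaming (_∈?_ to ∈?)
  open import Data.Product using (_×_; _,_; proj₁; proj₂; ∃-syntax; ∃₂)
  open import Level using (0ℓ)
  open import Relation.Unary using (Pred; Decidable)
  open import Relation.Unary.Properties using (∁?)
  open import Data.Empty using (⊥-elim)
  open import Relation.Nullary using (yes; no)
  open import Relation.Binary.Definitions using (DecidableEquality)
  open import Relation.Binary.PropositionalEquality

  module _ {A : Set} where

    ∈-─⁺ : ∀ {x y} {ys : List A} (x∈ys : x ∈ ys) → y ∈ ys → y ≢ x → y ∈ (ys ─ x∈ys)
    ∈-─⁺ (here refl) (here refl)  y≢x = ⊥-elim (y≢x refl)
    ∈-─⁺ (here refl) (there y∈ys) _   = y∈ys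
    ∈-─⁺ (there _)   (here refl)  _   = here refl
    ∈-─⁺ (there x∈ys) (there y∈ys) y≢x = there (∈-─⁺ x∈ys y∈ys y≢x)

    Unique∧⊆⇒length≤ : ∀ {xs ys : List A} → Unique xs → xs ⊆ ys → length xs ≤ length ys
    Unique∧⊆⇒length≤ [] _ = z≤n
    Unique∧⊆⇒length≤ {x ∷ xs} {ys} (x∉xs ∷ xs!) xs⊆ys =
      ℕ.≤-trans (s≤s (Unique∧⊆⇒length≤ xs! xs⊆ys─x)) (ℕ.≤-reflexive (sym (length-removeAt′ ys (index x∈ys))))
      where
      x∈ys = xs⊆ys (here refl)
      xs⊆ys─x : xs ⊆ (ys ─ x∈ys)
      xs⊆ys─x y∈xs = ∈-─⁺ x∈ys (xs⊆ys (there y∈xs)) (λ y≡x → All.lookup x∉xs y∈xs (sym y≡x))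

    Unique∧⊆∧length≥⇒⊇ : DecidableEquality A → ∀ {xs ys : List A} →
                          Unique xs → xs ⊆ ys → length ys ≤ length xs → ys ⊆ xs
    Unique∧⊆∧length≥⇒⊇ _≟_ {xs} {ys} xs! xs⊆ys ys≤xs {y} y∈ys with ∈? _≟_ y xs
    ... | yes y∈xs = y∈xs
    ... | no  y∉xs = ⊥-elim (ℕ.<-irrefl refl (ℕ.≤-trans (Unique∧⊆⇒length≤ y∷xs! y∷xs⊆ys) ys≤xs))
      where
      y∷xs! : Unique (y ∷ xs)
      y∷xs! = All.tabulate (λ x∈xs y≡x → y∉xs (subst (_∈ xs) (sym y≡x) x∈xs)) ∷ xs!
      y∷xs⊆ys : (y ∷ xs) ⊆ ys
      y∷xs⊆ys (here refl) = y∈ys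
      y∷xs⊆ys (there x∈xs) = xs⊆ys x∈xs

  module _ {A B : Set} where

    Unique-map⁺ : ∀ (f : A → B) {xs} → (∀ {x y} → x ∈ xs → y ∈ xs → f x ≡ f y → x ≡ y) →
                  Unique xs → Unique (map f xs)
    Unique-map⁺ f {[]} _ [] = []
    Unique-map⁺ f {x ∷ xs} f-inj (x∉xs ∷ xs!) =
      All.tabulate fx∉ ∷ Unique-map⁺ f (λ x∈ y∈ → f-inj (there x∈) (there y∈)) xs!
      where
      fx∉ : ∀ {z} → z ∈ map f xs → f x ≢ z
      fx∉ z∈ fx≡z with ∈.∈-map⁻ f z∈
      ... | y , y∈xs , refl = All.lookup x∉xs y∈xs (f-inj (here refl) (there y∈xs) fx≡z)

  module _ {A : Set} where

    length≡2⇒two-distinct : ∀ {xs : List A} → Unique xs → length xs ≡ 2 → ∃₂ λ x y → x ∈ xs × y ∈ xs × x ≢ y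
    length≡2⇒two-distinct {x ∷ y ∷ []} ((x≢y All.∷ All.[]) ∷ _) _ = x , y , here refl , there (here refl) , x≢y

  module _ {A B C : Set} where

    Unique-cartesianProductWith⁺ : ∀ (f : A → B → C) {xs ys} →
      (∀ {x x' y y'} → x ∈ xs → x' ∈ xs → y ∈ ys → y' ∈ ys → f x y ≡ f x' y' → x ≡ x' × y ≡ y') →
      Unique xs → Unique ys → Unique (cartesianProductWith f xs ys)
    Unique-cartesianProductWith⁺ f {[]} _ _ _ = []
    Unique-cartesianProductWith⁺ f {x ∷ xs} {ys} f-inj (x∉xs ∷ xs!) ys! = Unique.++⁺
      (Unique-map⁺ (f x) (λ y∈ y'∈ eq → proj₂ (f-inj (here refl) (here refl) y∈ y'∈ eq)) ys!)
      (Unique-cartesianProductWith⁺ f (λ x∈ x'∈ → f-inj (there x∈) (there x'∈)) xs! ys!)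
      disjoint
      where
      disjoint : Disjoint (map (f x) ys) (cartesianProductWith f xs ys)
      disjoint (z∈map , z∈rest) with ∈.∈-map⁻ (f x) z∈map | ∈.∈-cartesianProductWith⁻ f xs ys z∈rest
      ... | y , y∈ , refl | x' , y' , x'∈ , y'∈ , eq =
        All.lookup x∉xs x'∈ (proj₁ (f-inj (here refl) (there x'∈) y∈ y'∈ eq))

  length-filter+filter-∁ : ∀ {A : Set} {P : Pred A 0ℓ} (P? : Decidable P) xs →
                           length xs ≡ length (filter P? xs) ℕ.+ length (filter (∁? P?) xs)
  length-filter+filter-∁ P? [] = refl
  length-filter+filter-∁ P? (x ∷ xs) with P? x
  ... | yes _ = cong suc (length-filter+filter-∁ P? xs)
  ... | no  _ = trans (cong suc (length-filter+filter-∁ P? xs)) (sym (ℕ.+-suc _ _))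

  -- x ↦ (2h+1) ∸ x exchanges the elements ≤ h with those > h.
  reflection-closed⇒even : ∀ h {L : List ℕ} → Unique L → All (ℕ._< suc (h ℕ.+ h)) L →
                           (∀ {x} → x ∈ L → suc (h ℕ.+ h) ℕ.∸ x ∈ L) → ∃[ m ] length L ≡ m ℕ.+ m
  reflection-closed⇒even h {L} L! L<n L-closed =
    length low , trans (length-filter+filter-∁ (ℕ._≤? h) L) (cong (length low ℕ.+_) (ℕ.≤-antisym high≤low low≤high))
    where
    n = suc (h ℕ.+ h)
    low = filter (ℕ._≤? h) L
    high = filter (∁? (ℕ._≤? h)) L
    reflect-injective : ∀ {x y} → x ∈ L → y ∈ L → n ℕ.∸ x ≡ n ℕ.∸ y → x ≡ y
    reflect-injective x∈L y∈L eq =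
      ℕ.∸-cancelˡ-≡ (ℕ.<⇒≤ (All.lookup L<n x∈L)) (ℕ.<⇒≤ (All.lookup L<n y∈L)) eq
    length-reflect≤ : ∀ {P : Pred ℕ 0ℓ} (P? : Decidable P) {Q : Pred ℕ 0ℓ} (Q? : Decidable Q) →
                      (∀ {x} → P x → Q (n ℕ.∸ x)) → length (filter P? L) ≤ length (filter Q? L)
    length-reflect≤ P? Q? P⇒Q = subst (_≤ length (filter Q? L)) (length-map (n ℕ.∸_) (filter P? L))
      (Unique∧⊆⇒length≤ (Unique-map⁺ (n ℕ.∸_) (λ x∈ y∈ → reflect-injective (∈P x∈) (∈P y∈)) (Unique.filter⁺ P? L!))
                         reflected⊆)
      where
      ∈P = λ {x} (x∈ : x ∈ filter P? L) → proj₁ (∈.∈-filter⁻ P? x∈)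
      reflected⊆ : map (n ℕ.∸_) (filter P? L) ⊆ filter Q? L
      reflected⊆ z∈ with ∈.∈-map⁻ (n ℕ.∸_) z∈
      ... | x , x∈ , refl with ∈.∈-filter⁻ P? x∈
      ...   | x∈L , Px = ∈.∈-filter⁺ Q? (L-closed x∈L) (P⇒Q Px)
    low≤high : length low ≤ length high
    low≤high = length-reflect≤ (ℕ._≤? h) (∁? (ℕ._≤? h))
      (λ {x} x≤h n∸x≤h → ℕ.n≮n h (subst (_≤ h) n∸h≡1+h (ℕ.≤-trans (ℕ.∸-monoʳ-≤ n x≤h) n∸x≤h)))
      where
      n∸h≡1+h : n ℕ.∸ h ≡ suc h
      n∸h≡1+h = trans (cong (ℕ._∸ h) (sym (ℕ.+-suc h h))) (ℕ.m+n∸m≡n h (suc h))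
    high≤low : length high ≤ length low
    high≤low = length-reflect≤ (∁? (ℕ._≤? h)) (ℕ._≤? h)
      (λ {x} x≰h → subst (n ℕ.∸ x ≤_) (ℕ.m+n∸n≡m h h) (ℕ.∸-monoʳ-≤ n (ℕ.≰⇒> x≰h)))

module Residues where

  open import Data.Nat as ℕ using (ℕ; zero; suc; NonZero; _<_; _≤_; z≤n; s≤s)
  import Data.Nat.Properties as ℕ
  import Data.Nat.Divisibility as ℕ
  import Data.Nat.Tactic.RingSolver as NatSolver
  open import Data.Nat.DivMod using (m%n<n)
  open import Data.Nat.Primality using (Prime; euclidsLemma; prime⇒nonZero)
  open import Data.Nat.Coprimality using (coprime-Bézout; prime⇒coprime)
  open import Data.Nat.GCD using (module Bézout)
  open import Data.Integer as ℤ using (ℤ; +_; -_; _+_; _-_; _*_; _%ℕ_)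
  import Data.Integer.Properties as ℤ
  open import Data.Integer.DivMod using (n%ℕd<d)
  open import Data.Integer.Divisibility.Signed using (_∣_; _∣?_; ∣⇒∣ᵤ; ∣ᵤ⇒∣)
  open import Data.Integer.Tactic.RingSolver using (solve-∀)
  open import Data.List using (List; length; map; applyUpTo; upTo)
  open import Data.List.Properties using (length-map; length-applyUpTo)
  open import Data.List.Relation.Unary.All as All using (All; all?)
  open import Data.List.Relation.Unary.Unique.Propositional using (Unique)
  import Data.List.Relation.Unary.Unique.Propositional.Properties as Unique
  open import Data.List.Membership.Propositional using (_∈_)
  import Data.List.Membership.Propositional.Properties as ∈
  open import Data.Product using (∃-syntax; _×_; _,_; proj₁; proj₂)
  open import Data.Sum using (_⊎_; inj₁; inj₂; [_,_]′)
  open import Data.Empty using (⊥-elim)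
  open import Function using (_∘_)
  open import Relation.Nullary using (¬_; yes; no)
  open import Relation.Nullary.Decidable using (from-yes; _→-dec_; ¬?)
  open import Relation.Binary.PropositionalEquality
  open Congruence
  open Counting

  odd≢even : ∀ k m → suc (k ℕ.+ k) ≢ m ℕ.+ m
  odd≢even k zero    ()
  odd≢even k (suc m) eq = odd≢even m k (sym (trans (ℕ.suc-injective eq) (ℕ.+-suc m m)))

  euclidsLemmaℤ : ∀ {p} → Prime p → ∀ a b → (+ p) ∣ a * b → (+ p) ∣ a ⊎ (+ p) ∣ b
  euclidsLemmaℤ {p} p-prime a b p∣ab
    with euclidsLemma ℤ.∣ a ∣ ℤ.∣ b ∣ p-prime (subst (p ℕ.∣_) (ℤ.abs-* a b) (∣⇒∣ᵤ p∣ab))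
  ... | inj₁ p∣a = inj₁ (∣ᵤ⇒∣ p∣a)
  ... | inj₂ p∣b = inj₂ (∣ᵤ⇒∣ p∣b)

  ∣-*-cancelˡ-prime : ∀ {p} → Prime p → ∀ {e x} → ¬ (+ p ∣ e) → + p ∣ e * x → + p ∣ x
  ∣-*-cancelˡ-prime p-prime {e} {x} p∤e p∣ex with euclidsLemmaℤ p-prime e x p∣ex
  ... | inj₁ p∣e = ⊥-elim (p∤e p∣e)
  ... | inj₂ p∣x = p∣x

  ∣-*-cancelʳ-prime : ∀ {p} → Prime p → ∀ {e x} → ¬ (+ p ∣ e) → + p ∣ x * e → + p ∣ x
  ∣-*-cancelʳ-prime p-prime {e} {x} p∤e p∣xe = ∣-*-cancelˡ-prime p-prime p∤e (subst (_ ∣_) (ℤ.*-comm x e) p∣xe)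

  *-cancelˡ-mod-prime : ∀ {p} → Prime p → ∀ {c a b} → ¬ (+ p ∣ c) → c * a ≡ c * b [mod + p ] → a ≡ b [mod + p ]
  *-cancelˡ-mod-prime p-prime {c} {a} {b} p∤c (∣-difference p∣ca-cb) =
    ∣-difference (∣-*-cancelˡ-prime p-prime p∤c (subst (_ ∣_) (factor c a b) p∣ca-cb))
    where factor : ∀ c a b → c * a - c * b ≡ c * (a - b)
          factor = solve-∀

  *-cancelʳ-mod-prime : ∀ {p} → Prime p → ∀ {c a b} → ¬ (+ p ∣ c) → a * c ≡ b * c [mod + p ] → a ≡ b [mod + p ]
  *-cancelʳ-mod-prime p-prime {c} {a} {b} p∤c ac≡bc =
    *-cancelˡ-mod-prime p-prime p∤c (subst₂ (λ x y → x ≡ y [mod _ ]) (ℤ.*-comm a c) (ℤ.*-comm b c) ac≡bc)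

  ∤-below : ∀ {p n} → 0 < n → n < p → ¬ (+ p ∣ + n)
  ∤-below 0<n n<p p∣n = ℕ.<⇒≢ 0<n (sym (multiple-below⇒0 (∣⇒∣ᵤ p∣n) n<p))

  square≡1-mod-24 : ∀ n → n ℕ.% 4 ≡ 3 → ¬ (3 ℕ.∣ n) → + n * + n ≡ + 1 [mod + 24 ]
  square≡1-mod-24 n n%4≡3 3∤n = begin
    + n * + n            ≈⟨ *-cong-mod r≡n r≡n ⟨
    + r * + r            ≡⟨ ℤ.pos-* r r ⟨
    + (r ℕ.* r)          ≈⟨ %-≡-mod (r ℕ.* r) 24 ⟨
    + (r ℕ.* r ℕ.% 24)   ≡⟨ cong +_ (All.lookup residues-check (∈.∈-upTo⁺ (m%n<n n 24)) r%4≡3 r%3≢0) ⟩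
    + 1                  ∎
    where
    open ≡-mod-Reasoning (+ 24)
    residues-check : All (λ r → r ℕ.% 4 ≡ 3 → ¬ (r ℕ.% 3 ≡ 0) → r ℕ.* r ℕ.% 24 ≡ 1) (upTo 24)
    residues-check = from-yes (all? (λ r → r ℕ.% 4 ℕ.≟ 3 →-dec ¬? (r ℕ.% 3 ℕ.≟ 0) →-dec r ℕ.* r ℕ.% 24 ℕ.≟ 1)
                                    (upTo 24))
    r = n ℕ.% 24
    r≡n : + r ≡ + n [mod + 24 ]
    r≡n = %-≡-mod n 24
    r%4≡3 : r ℕ.% 4 ≡ 3
    r%4≡3 = trans (≡-mod⇒≡ (m%n<n r 4) (m%n<n n 4) (≡-mod-trans (%-≡-mod r 4)
              (≡-mod-trans (≡-mod-weakenʳ {+ 6} r≡n) (≡-mod-sym (%-≡-mod n 4))))) n%4≡3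
    r%3≢0 : ¬ (r ℕ.% 3 ≡ 0)
    r%3≢0 r%3≡0 = 3∤n (∣⇒∣ᵤ (≡0-mod⇒∣ (≡-mod-trans (≡-mod-weakenʳ {+ 8} (≡-mod-sym r≡n))
              (≡-mod-trans (≡-mod-sym (%-≡-mod r 3)) (≡⇒≡-mod (cong +_ r%3≡0))))))

  inverse-mod-prime : ∀ {p} → Prime p → ∀ {b} → ¬ (+ p ∣ b) → ∃[ y ] y * b ≡ + 1 [mod + p ]
  inverse-mod-prime {p} p-prime {b} p∤b = invert (coprime-Bézout (prime⇒coprime p-prime {{ℕ.>-nonZero r-pos}} (n%ℕd<d b p)))
    where
    instance
      p-nonZero : NonZero p
      p-nonZero = prime⇒nonZero p-prime
    open ≡-mod-Reasoning (+ p)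
    r = b %ℕ p
    r≡b : + r ≡ b [mod + p ]
    r≡b = %ℕ-≡-mod b p
    r-pos : 0 < r
    r-pos = ℕ.n≢0⇒n>0 λ eq → p∤b (≡0-mod⇒∣ (≡-mod-trans (≡-mod-sym r≡b) (≡⇒≡-mod (cong +_ eq))))
    lift : ∀ {a c d} → a ℕ.+ c ≡ d ℕ.* p → + a + + c ≡ + 0 [mod + p ]
    lift {a} {c} {d} eq =
      ≡-mod-trans (≡⇒≡-mod (trans (sym (ℤ.pos-+ a c)) (trans (cong +_ eq) (ℤ.pos-* d p)))) (multiple≡0-mod (+ d))
    invert : Bézout.Identity 1 p r → ∃[ y ] y * b ≡ + 1 [mod + p ]
    invert (Bézout.+- x y eq) = - + y , (begin
      - + y * b                   ≈⟨ *-congˡ-mod (- + y) r≡b ⟨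
      - + y * + r                 ≡⟨ regroup (+ y) (+ r) ⟩
      + 1 - (+ 1 + + y * + r)     ≡⟨ cong (λ z → + 1 - (+ 1 + z)) (ℤ.pos-* y r) ⟨
      + 1 - (+ 1 + + (y ℕ.* r))   ≈⟨ +-congˡ-mod (+ 1) (neg-cong-mod (lift {1} {y ℕ.* r} {x} eq)) ⟩
      + 1                         ∎)
      where regroup : ∀ y r → - y * r ≡ + 1 - (+ 1 + y * r)
            regroup = solve-∀
    invert (Bézout.-+ x y eq) = + y , (begin
      + y * b                     ≈⟨ *-congˡ-mod (+ y) r≡b ⟨
      + y * + r                   ≡⟨ ℤ.pos-* y r ⟨
      + (y ℕ.* r)                 ≡⟨ cong +_ eq ⟨
      + (1 ℕ.+ x ℕ.* p)           ≡⟨ ℤ.pos-+ 1 (x ℕ.* p) ⟩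
      + 1 + + (x ℕ.* p)           ≡⟨ cong (λ z → + 1 + z) (ℤ.pos-* x p) ⟩
      + 1 + + x * + p             ≈⟨ +-congˡ-mod (+ 1) (multiple≡0-mod (+ x)) ⟩
      + 1                         ∎)

  module QuadraticResidues (p : ℕ) (p-prime : Prime p) (k : ℕ) (p≡4k+3 : p ≡ 4 ℕ.* k ℕ.+ 3) where

    instance
      p-nonZero : NonZero p
      p-nonZero = prime⇒nonZero p-prime

    h : ℕ
    h = suc (k ℕ.+ k)

    p≡2h+1 : p ≡ suc (h ℕ.+ h)
    p≡2h+1 = trans p≡4k+3 (arith k)
      where arith : ∀ k → 4 ℕ.* k ℕ.+ 3 ≡ suc (suc (k ℕ.+ k) ℕ.+ suc (k ℕ.+ k))
            arith = NatSolver.solve-∀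

    h<p : h < p
    h<p = subst (h <_) (sym p≡2h+1) (s≤s (ℕ.m≤m+n h h))

    1<p : 1 < p
    1<p = ℕ.≤-<-trans (s≤s z≤n) h<p

    lowerHalf : List ℕ
    lowerHalf = applyUpTo suc h

    ∈-lowerHalf⁺ : ∀ {s} → 0 < s → s ≤ h → s ∈ lowerHalf
    ∈-lowerHalf⁺ {suc s} _ s<h = ∈.∈-applyUpTo⁺ suc s<h

    ∈-lowerHalf⁻ : ∀ {s} → s ∈ lowerHalf → 0 < s × s ≤ h
    ∈-lowerHalf⁻ s∈ with ∈.∈-applyUpTo⁻ suc s∈
    ... | i , i<h , refl = s≤s z≤n , i<h

    lowerHalf-unique : Unique lowerHalf
    lowerHalf-unique = Unique.applyUpTo⁺₁ suc h (λ i<j _ → ℕ.<⇒≢ i<j ∘ ℕ.suc-injective)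

    length-lowerHalf : length lowerHalf ≡ h
    length-lowerHalf = length-applyUpTo suc h

    nonzeroResidues : List ℕ
    nonzeroResidues = applyUpTo suc (h ℕ.+ h)

    ∈-nonzeroResidues⁺ : ∀ {w} → 0 < w → w < p → w ∈ nonzeroResidues
    ∈-nonzeroResidues⁺ {suc w} _ w<p = ∈.∈-applyUpTo⁺ suc (ℕ.≤-pred (subst (suc w <_) p≡2h+1 w<p))

    length-nonzeroResidues : length nonzeroResidues ≡ h ℕ.+ h
    length-nonzeroResidues = length-applyUpTo suc (h ℕ.+ h)

    +-lowerHalf<p : ∀ {s s'} → s ∈ lowerHalf → s' ∈ lowerHalf → s ℕ.+ s' < p
    +-lowerHalf<p s∈ s'∈ =
      subst (_ <_) (sym p≡2h+1) (s≤s (ℕ.+-mono-≤ (proj₂ (∈-lowerHalf⁻ s∈)) (proj₂ (∈-lowerHalf⁻ s'∈))))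

    lowerHalf<p : ∀ {s} → s ∈ lowerHalf → s < p
    lowerHalf<p s∈ = ℕ.≤-<-trans (proj₂ (∈-lowerHalf⁻ s∈)) h<p

    p∤lowerHalf : ∀ {s} → s ∈ lowerHalf → ¬ (+ p ∣ + s)
    p∤lowerHalf s∈ = ∤-below (proj₁ (∈-lowerHalf⁻ s∈)) (lowerHalf<p s∈)

    p∤double-lowerHalf : ∀ {s} → s ∈ lowerHalf → ¬ (+ p ∣ + 2 * + s)
    p∤double-lowerHalf {s} s∈ p∣2s =
      ∤-below (ℕ.≤-trans (proj₁ (∈-lowerHalf⁻ s∈)) (ℕ.m≤m+n s s)) (+-lowerHalf<p s∈ s∈)
      (subst (+ p ∣_) (trans (double (+ s)) (sym (ℤ.pos-+ s s))) p∣2s)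
      where double : ∀ s → + 2 * s ≡ s + s
            double = solve-∀

    squares-injective : ∀ {s s'} → s ∈ lowerHalf → s' ∈ lowerHalf →
                        + s * + s ≡ + s' * + s' [mod + p ] → s ≡ s'
    squares-injective {s} {s'} s∈ s'∈ (∣-difference p∣s²-s'²)
      with euclidsLemmaℤ p-prime (+ s - + s') (+ s + + s') (subst (+ p ∣_) (factor (+ s) (+ s')) p∣s²-s'²)
      where factor : ∀ a b → a * a - b * b ≡ (a - b) * (a + b)
            factor = solve-∀
    ... | inj₁ p∣s-s' = ≡-mod⇒≡ (lowerHalf<p s∈) (lowerHalf<p s'∈) (∣-difference p∣s-s')
    ... | inj₂ p∣s+s' = ⊥-elim (∤-below (ℕ.≤-trans (proj₁ (∈-lowerHalf⁻ s∈)) (ℕ.m≤m+n s s'))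
                                           (+-lowerHalf<p s∈ s'∈)
                                   (subst (+ p ∣_) (sym (ℤ.pos-+ s s')) p∣s+s'))

    lowerHalf-representative : ∀ {r} → 0 < r → r < p → ∃[ t ] t ∈ lowerHalf × + t * + t ≡ + r * + r [mod + p ]
    lowerHalf-representative {r} 0<r r<p with r ℕ.≤? h
    ... | yes r≤h = r , ∈-lowerHalf⁺ 0<r r≤h , ≡-mod-refl
    ... | no  r≰h = p ℕ.∸ r , ∈-lowerHalf⁺ (ℕ.m<n⇒0<n∸m r<p) p∸r≤h , p-r²≡r²
      where
      p∸r≤h : p ℕ.∸ r ≤ h
      p∸r≤h = subst (p ℕ.∸ r ≤_) (trans (cong (ℕ._∸ suc h) p≡2h+1) (ℕ.m+n∸n≡m h h))
                    (ℕ.∸-monoʳ-≤ p (ℕ.≰⇒> r≰h))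
      p-r²≡r² : + (p ℕ.∸ r) * + (p ℕ.∸ r) ≡ + r * + r [mod + p ]
      p-r²≡r² = begin
        + (p ℕ.∸ r) * + (p ℕ.∸ r)         ≡⟨ cong (λ z → z * z) (+-∸ (ℕ.<⇒≤ r<p)) ⟩
        (+ p - + r) * (+ p - + r)         ≡⟨ expand (+ p) (+ r) ⟩
        (+ p - + r - + r) * + p + + r * + r ≈⟨ +-congʳ-mod (+ r * + r) (multiple≡0-mod (+ p - + r - + r)) ⟩
        + 0 + + r * + r                    ≡⟨ ℤ.+-identityˡ (+ r * + r) ⟩
        + r * + r                          ∎
        where
        open ≡-mod-Reasoning (+ p)
        expand : ∀ p r → (p - r) * (p - r) ≡ (p - r - r) * p + r * r
        expand = solve-∀

    square : ℕ → ℕ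
    square s = (s ℕ.* s) ℕ.% p

    square≡ : ∀ s → + square s ≡ + s * + s [mod + p ]
    square≡ s = subst (λ z → + square s ≡ z [mod + p ]) (ℤ.pos-* s s) (%-≡-mod (s ℕ.* s) p)

    square-positive : ∀ {s} → s ∈ lowerHalf → 0 < square s
    square-positive {s} s∈ = ℕ.n≢0⇒n>0 λ eq → [ p∤lowerHalf s∈ , p∤lowerHalf s∈ ]′
      (euclidsLemmaℤ p-prime (+ s) (+ s) (≡0-mod⇒∣ (≡-mod-trans (≡-mod-sym (square≡ s)) (≡⇒≡-mod (cong +_ eq)))))

    squares : List ℕ
    squares = map square lowerHalf

    squares-unique : Unique squares
    squares-unique = Unique-map⁺ square (λ {s} {s'} s∈ s'∈ eq → squares-injective s∈ s'∈
      (≡-mod-trans (≡-mod-sym (square≡ s)) (≡-mod-trans (≡⇒≡-mod (cong +_ eq)) (square≡ s'))))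
      lowerHalf-unique

    squares<p : All (_< p) squares
    squares<p = All.tabulate bound
      where
      bound : ∀ {x} → x ∈ squares → x < p
      bound x∈ with ∈.∈-map⁻ square {xs = lowerHalf} x∈
      ... | s , _ , refl = m%n<n (s ℕ.* s) p

    squares-closed-under-negation : ∀ {i} → i * i + + 1 ≡ + 0 [mod + p ] → ∀ {x} → x ∈ squares → p ℕ.∸ x ∈ squares
    squares-closed-under-negation {i} i²+1≡0 x∈ with ∈.∈-map⁻ square {xs = lowerHalf} x∈
    ... | s , s∈ , refl = subst (_∈ squares) square-t≡p∸square-s (∈.∈-map⁺ square t∈)
      where
      p∤i : ¬ (+ p ∣ i)
      p∤i p∣i = ∤-below (s≤s z≤n) 1<p (≡0-mod⇒∣ (begin
        + 1                      ≡⟨⟩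
        + 0 * + 0 + + 1          ≈⟨ +-congʳ-mod (+ 1) (*-cong-mod i≡0 i≡0) ⟨
        i * i + + 1              ≈⟨ i²+1≡0 ⟩
        + 0                      ∎))
        where open ≡-mod-Reasoning (+ p)
              i≡0 = ∣⇒≡0-mod p∣i
      r = (i * + s) %ℕ p
      r≡is : + r ≡ i * + s [mod + p ]
      r≡is = %ℕ-≡-mod (i * + s) p
      r-positive : 0 < r
      r-positive = ℕ.n≢0⇒n>0 λ eq → [ p∤i , p∤lowerHalf s∈ ]′
        (euclidsLemmaℤ p-prime i (+ s) (≡0-mod⇒∣ (≡-mod-trans (≡-mod-sym r≡is) (≡⇒≡-mod (cong +_ eq)))))
      representative = lowerHalf-representative r-positive (n%ℕd<d (i * + s) p)
      t = proj₁ representative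
      t∈ = proj₁ (proj₂ representative)
      square-t≡p∸square-s : square t ≡ p ℕ.∸ square s
      square-t≡p∸square-s =
        ≡-mod⇒≡ (m%n<n (t ℕ.* t) p) (ℕ.∸-monoʳ-< (square-positive s∈) (ℕ.<⇒≤ (m%n<n (s ℕ.* s) p))) (begin
        + square t                               ≈⟨ square≡ t ⟩
        + t * + t                                ≈⟨ proj₂ (proj₂ representative) ⟩
        + r * + r                                ≈⟨ *-cong-mod r≡is r≡is ⟩
        i * + s * (i * + s)                      ≡⟨ regroup i (+ s) ⟩
        (i * i + + 1) * (+ s * + s) - + s * + s  ≈⟨ -‿cong-mod (*-congʳ-mod (+ s * + s) i²+1≡0) (≡-mod-sym (square≡ s)) ⟩
        + 0 * (+ s * + s) - + square s           ≈⟨ +-congʳ-mod (- + square s) (≡-mod-sym modulus≡0-mod) ⟩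
        + p - + square s                         ≡⟨ +-∸ (ℕ.<⇒≤ (m%n<n (s ℕ.* s) p)) ⟨
        + (p ℕ.∸ square s)                       ∎)
        where open ≡-mod-Reasoning (+ p)
              regroup : ∀ i s → i * s * (i * s) ≡ (i * i + + 1) * (s * s) - s * s
              regroup = solve-∀

    length-squares : length squares ≡ h
    length-squares = trans (length-map square lowerHalf) length-lowerHalf

    -- The h = 2k+1 squares would pair off under x ↦ p ∸ x.
    −1-nonresidue : ∀ i → ¬ (i * i + + 1 ≡ + 0 [mod + p ])
    −1-nonresidue i i²+1≡0 = odd≢even k (proj₁ squares-even) (trans (sym length-squares) (proj₂ squares-even))
      where
      squares-even : ∃[ m ] length squares ≡ m ℕ.+ m
      squares-even = reflection-closed⇒even h squares-unique (subst (λ n → All (_< n) squares) p≡2h+1 squares<p)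
        (λ {x} x∈ → subst (λ n → n ℕ.∸ x ∈ squares) p≡2h+1 (squares-closed-under-negation {i} i²+1≡0 x∈))

    sum-of-squares : ∀ a b → a * a + b * b ≡ + 0 [mod + p ] → + p ∣ b
    sum-of-squares a b a²+b²≡0 with + p ∣? b
    ... | yes p∣b = p∣b
    ... | no  p∤b with inverse-mod-prime p-prime p∤b
    ...   | y , yb≡1 = ⊥-elim (−1-nonresidue (y * a) (begin
      y * a * (y * a) + + 1           ≈⟨ +-congˡ-mod (y * a * (y * a)) (*-cong-mod yb≡1 yb≡1) ⟨
      y * a * (y * a) + y * b * (y * b) ≡⟨ factor y a b ⟩
      y * y * (a * a + b * b)         ≈⟨ *-congˡ-mod (y * y) a²+b²≡0 ⟩
      y * y * + 0                     ≡⟨ ℤ.*-zeroʳ (y * y) ⟩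
      + 0                             ∎))
      where open ≡-mod-Reasoning (+ p)
            factor : ∀ y a b → y * a * (y * a) + y * b * (y * b) ≡ y * y * (a * a + b * b)
            factor = solve-∀

module BaseBlocks where

  open import Data.Nat as ℕ using (ℕ; _<_)
  import Data.Nat.Properties as ℕ
  open import Data.Nat.DivMod using (_mod_)
  open import Data.Integer as ℤ using (ℤ; +_; -_; _-_; _*_)
  open import Data.Fin using (Fin; toℕ)
  import Data.Fin.Properties as Fin
  open import Data.List using (List; []; _∷_; length; lookup; allFin; concatMap; filter; cartesianProduct)
  open import Data.List.Relation.Unary.All as All using (All; all?)
  open import Data.List.Relation.Unary.Unique.Propositional using (Unique)
  open import Data.List.Relation.Unary.Unique.DecPropositional using (unique?)
  import Data.List.Relation.Unary.Unique.Propositional.Properties as Unique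
  open import Data.List.Membership.Propositional using (_∈_)
  import Data.List.Membership.Propositional.Properties as ∈
  open import Data.List.Membership.DecPropositional ℕ._≟_ using (_∈?_)
  open import Data.Product using (_×_; _,_; ∃₂)
  open import Data.Product.Properties using (≡-dec)
  open import Data.Sum using (_⊎_; inj₁; inj₂)
  open import Relation.Nullary using (Dec; yes; no)
  open import Relation.Nullary.Decidable using (from-yes; _×-dec_; _⊎-dec_; _→-dec_; map′)
  open import Relation.Binary.Definitions using (DecidableEquality)
  open import Relation.Binary.PropositionalEquality
  open import Defs using (G; subG)
  open Counting using (length≡2⇒two-distinct)

  -- ((a , b) , c) stands for the point (a , p b + 24 s² c) of Z₄ × Z₂₄ₚ in the s-th translate.
  BaseElt : Set
  BaseElt = G 4 24 × ℕ

  _≟ᴳ_ : DecidableEquality (G 4 24)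
  _≟ᴳ_ = ≡-dec Fin._≟_ Fin._≟_

  _≟ᴮ_ : DecidableEquality BaseElt
  _≟ᴮ_ = ≡-dec _≟ᴳ_ ℕ._≟_

  el : ℕ → ℕ → ℕ → BaseElt
  el a b c = (a mod 4 , b mod 24) , c

  baseBlocks : List (List BaseElt)
  baseBlocks =
    (el 0 0 0 ∷ el 0 0 5 ∷ el 0 1 1 ∷ el 2 1 4 ∷ []) ∷
    (el 0 0 0 ∷ el 0 12 3 ∷ el 1 0 5 ∷ el 3 12 8 ∷ []) ∷
    (el 0 20 0 ∷ el 1 2 1 ∷ el 2 16 2 ∷ el 2 18 3 ∷ el 3 23 4 ∷ []) ∷
    (el 0 4 0 ∷ el 3 22 1 ∷ el 2 8 2 ∷ el 2 6 3 ∷ el 1 1 4 ∷ []) ∷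
    (el 3 20 0 ∷ el 2 12 1 ∷ el 2 17 2 ∷ el 3 11 3 ∷ el 0 7 4 ∷ []) ∷
    (el 1 4 0 ∷ el 2 12 1 ∷ el 2 7 2 ∷ el 1 13 3 ∷ el 0 17 4 ∷ []) ∷
    (el 1 7 0 ∷ el 1 0 1 ∷ el 3 15 2 ∷ el 2 17 3 ∷ el 1 4 4 ∷ []) ∷
    (el 3 17 0 ∷ el 3 0 1 ∷ el 1 9 2 ∷ el 2 7 3 ∷ el 3 20 4 ∷ []) ∷
    (el 3 5 0 ∷ el 3 16 1 ∷ el 0 20 2 ∷ el 1 22 3 ∷ []) ∷
    (el 1 19 0 ∷ el 1 8 1 ∷ el 0 4 2 ∷ el 3 2 3 ∷ []) ∷
    (el 0 10 0 ∷ el 1 5 1 ∷ el 1 11 2 ∷ el 1 19 3 ∷ []) ∷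
    (el 0 14 0 ∷ el 3 19 1 ∷ el 3 13 2 ∷ el 3 5 3 ∷ []) ∷ []

  BasePair : Set
  BasePair = BaseElt × BaseElt

  -- Enumerated exactly as ΔB enumerates differences, so that the differences of a translate of B
  -- are, by computation, those of the pairs of B.
  pairsOf : List BaseElt → List BasePair
  pairsOf B = concatMap (λ i → concatMap (λ j → pairAt i j) (allFin (length B))) (allFin (length B))
    where
    pairAt : Fin (length B) → Fin (length B) → List BasePair
    pairAt i j with toℕ i ℕ.≟ toℕ j
    ... | yes _ = []
    ... | no  _ = (lookup B i , lookup B j) ∷ []

  basePairs : List BasePair
  basePairs = concatMap pairsOf baseBlocks

  code : BasePair → G 4 24
  code ((u , _) , (v , _)) = subG 4 24 u v

  Δc : BasePair → ℤ
  Δc ((_ , c) , (_ , c')) = + c - + c'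

  -- e'/e ∈ {−1, −4, −¼}, a non-square modulo every prime p ≡ 3 (mod 4).
  data NonsquareRatio (e e' : ℤ) : Set where
    ratio-−1 : e' ≡ - e → NonsquareRatio e e'
    ratio-−4 : e' ≡ - (+ 4 * e) → NonsquareRatio e e'
    ratio-−¼ : e ≡ - (+ 4 * e') → NonsquareRatio e e'

  nonsquareRatio? : ∀ e e' → Dec (NonsquareRatio e e')
  nonsquareRatio? e e' = map′ to from (e' ℤ.≟ - e ⊎-dec e' ℤ.≟ - (+ 4 * e) ⊎-dec e ℤ.≟ - (+ 4 * e'))
    where
    to : _ → NonsquareRatio e e'
    to (inj₁ eq) = ratio-−1 eq
    to (inj₂ (inj₁ eq)) = ratio-−4 eq
    to (inj₂ (inj₂ eq)) = ratio-−¼ eq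
    from : NonsquareRatio e e' → _
    from (ratio-−1 eq) = inj₁ eq
    from (ratio-−4 eq) = inj₂ (inj₁ eq)
    from (ratio-−¼ eq) = inj₂ (inj₂ eq)

  -- Not divisible by any prime p ≥ 7.
  Small : ℤ → Set
  Small e = (0 < ℤ.∣ e ∣ × ℤ.∣ e ∣ < 7) ⊎ ℤ.∣ e ∣ ≡ 8

  small? : ∀ e → Dec (Small e)
  small? e = (0 ℕ.<? ℤ.∣ e ∣ ×-dec ℤ.∣ e ∣ ℕ.<? 7) ⊎-dec ℤ.∣ e ∣ ℕ.≟ 8

  basePairs-unique : Unique basePairs
  basePairs-unique = from-yes (unique? (≡-dec _≟ᴮ_ _≟ᴮ_) basePairs)

  allCodes : List (G 4 24)
  allCodes = cartesianProduct (allFin 4) (allFin 24)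

  ∈-allCodes : ∀ u → u ∈ allCodes
  ∈-allCodes (a , b) = ∈.∈-cartesianProduct⁺ (∈.∈-allFin a) (∈.∈-allFin b)

  withCode : G 4 24 → List BasePair
  withCode u = filter (λ P → code P ≟ᴳ u) basePairs

  codes-twice : All (λ u → length (withCode u) ≡ 2) allCodes
  codes-twice = from-yes (all? (λ u → length (withCode u) ℕ.≟ 2) allCodes)

  Δc-small : All (λ P → Small (Δc P)) basePairs
  Δc-small = from-yes (all? (λ P → small? (Δc P)) basePairs)

  blocks-valid : All (λ B → Unique B × length B ∈ 4 ∷ 5 ∷ []) baseBlocks
  blocks-valid = from-yes (all? (λ B → unique? _≟ᴮ_ B ×-dec length B ∈? (4 ∷ 5 ∷ [])) baseBlocks)

  blocks-Δc-small : All (λ B → All (λ x → All (λ y → x ≡ y ⊎ Small (Δc (x , y))) B) B) baseBlocks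
  blocks-Δc-small = from-yes (all? (λ B → all? (λ x → all? (λ y → x ≟ᴮ y ⊎-dec small? (Δc (x , y))) B) B) baseBlocks)

  same-code⇒nonsquareRatio :
    All (λ P → All (λ P' → code P ≡ code P' → P ≡ P' ⊎ NonsquareRatio (Δc P) (Δc P')) basePairs) basePairs
  same-code⇒nonsquareRatio = from-yes (all? (λ P → all? (λ P' →
    code P ≟ᴳ code P' →-dec (≡-dec _≟ᴮ_ _≟ᴮ_ P P' ⊎-dec nonsquareRatio? (Δc P) (Δc P'))) basePairs) basePairs)

  twins : ∀ u → ∃₂ λ P P' → P ∈ basePairs × P' ∈ basePairs × code P ≡ u × code P' ≡ u × P ≢ P'
  twins u = twins-of (length≡2⇒two-distinct withCode-unique (All.lookup codes-twice (∈-allCodes u)))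
    where
    withCode-unique : Unique (withCode u)
    withCode-unique = Unique.filter⁺ (λ P → code P ≟ᴳ u) basePairs-unique
    ∈-withCode⁻ : ∀ {P} → P ∈ withCode u → P ∈ basePairs × code P ≡ u
    ∈-withCode⁻ = ∈.∈-filter⁻ (λ P → code P ≟ᴳ u)
    twins-of : (∃₂ λ P P' → P ∈ withCode u × P' ∈ withCode u × P ≢ P') →
               ∃₂ λ P P' → P ∈ basePairs × P' ∈ basePairs × code P ≡ u × code P' ≡ u × P ≢ P'
    twins-of (P , P' , P∈ , P'∈ , P≢P') with ∈-withCode⁻ P∈ | ∈-withCode⁻ P'∈
    ... | P∈basePairs , codeP≡u | P'∈basePairs , codeP'≡u =
      P , P' , P∈basePairs , P'∈basePairs , codeP≡u , codeP'≡u , P≢P'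

open import Data.Nat using (ℕ; _%_; _≥_)
open import Data.Nat.Primality using (Prime)
open import Relation.Binary.PropositionalEquality using (_≡_)

module Construction (p : ℕ) (p-prime : Prime p) (p%4≡3 : p % 4 ≡ 3) (p≥7 : p ≥ 7) where
  open import Data.Nat as ℕ using (ℕ; NonZero; _<_; _≤_)
  open import Relation.Binary.PropositionalEquality
  import Data.Nat.Properties as ℕ
  import Data.Nat.Divisibility as ℕ
  import Data.Nat.Tactic.RingSolver as NatSolver
  open import Data.Nat.DivMod using (_mod_; m≡m%n+[m/n]*n; m%n<n; m*n/n≡m)
  open import Data.Nat.Primality using (euclidsLemma; prime⇒irreducible)
  open import Data.Integer as ℤ using (ℤ; +_; -_; _+_; _-_; _*_; _%ℕ_)
  import Data.Integer.Properties as ℤ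
  open import Data.Integer.DivMod using (n%ℕd<d)
  open import Data.Integer.Divisibility.Signed using (_∣_; ∣⇒∣ᵤ; ∣ᵤ⇒∣; ∣m⇒∣-m)
  open import Data.Integer.Tactic.RingSolver using (solve-∀)
  open import Data.Fin using (toℕ)
  import Data.Fin.Properties as Fin
  open import Data.List using (List; []; _∷_; _++_; map; concatMap; filter; length; cartesianProductWith)
  open import Data.List.Properties using (length-map; length-++; concatMap-++; filter-++)
  open import Data.List.Relation.Unary.All as All using (All)
  open import Data.List.Relation.Unary.All.Properties using (concat⁺; map⁺)
  open import Data.List.Relation.Unary.Any using (here; there)
  open import Data.List.Relation.Unary.Unique.Propositional using (Unique)
  import Data.List.Relation.Unary.Unique.Propositional.Properties as Unique
  open import Data.List.Relation.Binary.Subset.Propositional using (_⊆_)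
  open import Data.List.Relation.Binary.Disjoint.Propositional using (Disjoint)
  open import Data.List.Membership.Propositional using (_∈_; _∉_)
  import Data.List.Membership.Propositional.Properties as ∈
  open import Data.Product using (_×_; _,_; proj₁; proj₂; ∃-syntax; ∃₂)
  open import Data.Sum as Sum using (_⊎_; inj₁; inj₂; [_,_]′)
  open import Data.Empty using (⊥-elim)
  open import Function using (_∘_)
  open import Function.Bundles using (_⇔_; mk⇔; Equivalence)
  open import Relation.Nullary using (¬_)
  open import Relation.Nullary.Decidable using (decidable-stable)
  open import Defs using (G; subZ; subG; ΔB; ΔFamily; countSize; IsBDP)
  open Congruence
  open Counting
  open Residues
  open BaseBlocks

  k : ℕ
  k = p ℕ./ 4

  p≡4k+3 : p ≡ 4 ℕ.* k ℕ.+ 3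
  p≡4k+3 = trans (m≡m%n+[m/n]*n p 4) (trans (cong (ℕ._+ k ℕ.* 4) p%4≡3) (comm k))
    where comm : ∀ k → 3 ℕ.+ k ℕ.* 4 ≡ 4 ℕ.* k ℕ.+ 3
          comm = NatSolver.solve-∀

  open QuadraticResidues p p-prime k p≡4k+3

  p∤below-7 : ∀ {n} → 0 < n → n < 7 → ¬ (p ℕ.∣ n)
  p∤below-7 0<n n<7 p∣n = ℕ.<⇒≱ n<7 (ℕ.≤-trans p≥7 (ℕ.∣⇒≤ {{ℕ.>-nonZero 0<n}} p∣n))

  p∤8 : ¬ (p ℕ.∣ 8)
  p∤8 p∣8 = [ p∤below-7 (ℕ.<ᵇ⇒< 0 2 _) (ℕ.<ᵇ⇒< 2 7 _) , p∤below-7 (ℕ.<ᵇ⇒< 0 4 _) (ℕ.<ᵇ⇒< 4 7 _) ]′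
    (euclidsLemma 2 4 p-prime p∣8)

  p∤24 : ¬ (p ℕ.∣ 24)
  p∤24 p∣24 = [ p∤below-7 (ℕ.<ᵇ⇒< 0 3 _) (ℕ.<ᵇ⇒< 3 7 _) , p∤8 ]′ (euclidsLemma 3 8 p-prime p∣24)

  p∤small : ∀ {e} → Small e → ¬ (+ p ∣ e)
  p∤small (inj₁ (0<∣e∣ , ∣e∣<7)) p∣e = p∤below-7 0<∣e∣ ∣e∣<7 (∣⇒∣ᵤ p∣e)
  p∤small (inj₂ ∣e∣≡8)          p∣e = p∤8 (subst (p ℕ.∣_) ∣e∣≡8 (∣⇒∣ᵤ p∣e))

  p²≡1 : + p * + p ≡ + 1 [mod + 24 ]
  p²≡1 = square≡1-mod-24 p p%4≡3 3∤p
    where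
    3∤p : ¬ (3 ℕ.∣ p)
    3∤p 3∣p with prime⇒irreducible p-prime 3∣p
    ... | inj₁ ()
    ... | inj₂ 3≡p = ℕ.<⇒≱ (ℕ.<ᵇ⇒< 3 7 _) (subst (7 ≤_) (sym 3≡p) p≥7)

  N : ℕ
  N = 24 ℕ.* p

  instance
    N-nonZero : NonZero N
    N-nonZero = ℕ.m*n≢0 24 p {{_}} {{p-nonZero}}

  point : ℕ → BaseElt → G 4 N
  point s ((a , b) , c) = a , (p ℕ.* toℕ b ℕ.+ 24 ℕ.* (s ℕ.* s ℕ.* c)) mod N

  difference : ℕ → BasePair → G 4 N
  difference s (x , y) = subG 4 N (point s x) (point s y)

  residue : ℕ → BasePair → ℤ
  residue s P = + 24 * (+ s * + s * Δc P)

  -- Since p² ≡ 1 (mod 24), multiplying by p undoes the factor p in front of b − b' (see code-difference).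
  codeOf : G 4 N → G 4 24
  codeOf (a , z) = a , (p ℕ.* toℕ z) mod 24

  lift : ℕ → BaseElt → ℤ
  lift s ((_ , b) , c) = + p * + toℕ b + + 24 * (+ s * + s * + c)

  mod-N⇒mod-24*p : ∀ {a b} → a ≡ b [mod + N ] → a ≡ b [mod + 24 * + p ]
  mod-N⇒mod-24*p {a} {b} = subst (λ m → a ≡ b [mod m ]) (ℤ.pos-* 24 p)

  mod-24*p⇒mod-N : ∀ {a b} → a ≡ b [mod + 24 * + p ] → a ≡ b [mod + N ]
  mod-24*p⇒mod-N {a} {b} = subst (λ m → a ≡ b [mod m ]) (sym (ℤ.pos-* 24 p))

  point≡lift : ∀ s x → + toℕ (proj₂ (point s x)) ≡ lift s x [mod + 24 * + p ]
  point≡lift s ((a , b) , c) = mod-N⇒mod-24*p (≡-mod-trans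
    (mod-≡-mod (p ℕ.* toℕ b ℕ.+ 24 ℕ.* (s ℕ.* s ℕ.* c)) N)
    (≡⇒≡-mod (trans (ℤ.pos-+ (p ℕ.* toℕ b) _) (cong₂ _+_ (ℤ.pos-* p (toℕ b))
      (trans (ℤ.pos-* 24 (s ℕ.* s ℕ.* c)) (cong (+ 24 *_) (trans (ℤ.pos-* (s ℕ.* s) c) (cong (_* + c) (ℤ.pos-* s s)))))))))

  difference≡lift : ∀ s x y → + toℕ (proj₂ (difference s (x , y))) ≡ lift s x - lift s y [mod + 24 * + p ]
  difference≡lift s x y = ≡-mod-trans
    (mod-N⇒mod-24*p (subZ-≡-mod N (proj₂ (point s x)) (proj₂ (point s y))))
    (-‿cong-mod (point≡lift s x) (point≡lift s y))

  lift-difference-mod-p : ∀ s x y → lift s x - lift s y ≡ residue s (x , y) [mod + p ]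
  lift-difference-mod-p s x@((_ , b) , c) y@((_ , b') , c') = begin
    lift s x - lift s y                             ≡⟨ regroup (+ p) (+ s) (+ toℕ b) (+ toℕ b') (+ c) (+ c') ⟩
    (+ toℕ b - + toℕ b') * + p + residue s (x , y)  ≈⟨ +-congʳ-mod (residue s (x , y)) (multiple≡0-mod (+ toℕ b - + toℕ b')) ⟩
    + 0 + residue s (x , y)                         ≡⟨ ℤ.+-identityˡ (residue s (x , y)) ⟩
    residue s (x , y)                               ∎
    where
    open ≡-mod-Reasoning (+ p)
    regroup : ∀ p s b b' c c' →
              p * b + + 24 * (s * s * c) - (p * b' + + 24 * (s * s * c')) ≡ (b - b') * p + + 24 * (s * s * (c - c'))
    regroup = solve-∀

  lift-difference-mod-24 : ∀ s x y → lift s x - lift s y ≡ + p * + toℕ (proj₂ (code (x , y))) [mod + 24 ]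
  lift-difference-mod-24 s x@((_ , b) , c) y@((_ , b') , c') = begin
    lift s x - lift s y                                     ≡⟨ regroup (+ p) (+ s) (+ toℕ b) (+ toℕ b') (+ c) (+ c') ⟩
    + p * (+ toℕ b - + toℕ b') + (+ s * + s * (+ c - + c')) * + 24
                                                            ≈⟨ +-congˡ-mod (+ p * (+ toℕ b - + toℕ b')) (multiple≡0-mod (+ s * + s * (+ c - + c'))) ⟩
    + p * (+ toℕ b - + toℕ b') + + 0                        ≡⟨ ℤ.+-identityʳ (+ p * (+ toℕ b - + toℕ b')) ⟩
    + p * (+ toℕ b - + toℕ b')                              ≈⟨ *-congˡ-mod (+ p) (subZ-≡-mod 24 b b') ⟨
    + p * + toℕ (subZ 24 b b')                              ∎
    where
    open ≡-mod-Reasoning (+ 24)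
    regroup : ∀ p s b b' c c' →
              p * b + + 24 * (s * s * c) - (p * b' + + 24 * (s * s * c')) ≡ p * (b - b') + (s * s * (c - c')) * + 24
    regroup = solve-∀

  residue-difference : ∀ s P → + toℕ (proj₂ (difference s P)) ≡ residue s P [mod + p ]
  residue-difference s (x , y) = ≡-mod-trans (≡-mod-weakenʳ {+ 24} (difference≡lift s x y)) (lift-difference-mod-p s x y)

  difference-mod-24 : ∀ s P → + toℕ (proj₂ (difference s P)) ≡ + p * + toℕ (proj₂ (code P)) [mod + 24 ]
  difference-mod-24 s (x , y) = ≡-mod-trans (≡-mod-weakenˡ {n = + p} (difference≡lift s x y)) (lift-difference-mod-24 s x y)

  p*[p*a]≡a : ∀ a → + p * (+ p * a) ≡ a [mod + 24 ]
  p*[p*a]≡a a = begin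
    + p * (+ p * a)  ≡⟨ ℤ.*-assoc (+ p) (+ p) a ⟨
    + p * + p * a    ≈⟨ *-congʳ-mod a p²≡1 ⟩
    + 1 * a          ≡⟨ ℤ.*-identityˡ a ⟩
    a                ∎
    where open ≡-mod-Reasoning (+ 24)

  p*-mod-24 : ∀ z → + toℕ ((p ℕ.* z) mod 24) ≡ + p * + z [mod + 24 ]
  p*-mod-24 z = ≡-mod-trans (mod-≡-mod (p ℕ.* z) 24) (≡⇒≡-mod (ℤ.pos-* p z))

  code-difference : ∀ s P → codeOf (difference s P) ≡ code P
  code-difference s P@(((a , b) , _) , ((a' , b') , _)) =
    cong (subZ 4 a a' ,_) (Fin.toℕ-injective (≡-mod⇒≡ (Fin.toℕ<n _) (Fin.toℕ<n _) (begin
      + toℕ ((p ℕ.* z) mod 24)        ≈⟨ p*-mod-24 z ⟩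
      + p * + z                       ≈⟨ *-congˡ-mod (+ p) (difference-mod-24 s P) ⟩
      + p * (+ p * + toℕ (subZ 24 b b')) ≈⟨ p*[p*a]≡a _ ⟩
      + toℕ (subZ 24 b b')            ∎)))
    where
    open ≡-mod-Reasoning (+ 24)
    z = toℕ (proj₂ (difference s P))

  difference-determined : ∀ s P g → codeOf g ≡ code P → + toℕ (proj₂ g) ≡ residue s P [mod + p ] → difference s P ≡ g
  difference-determined s P@(((a , b) , _) , ((a' , b') , _)) (g₁ , g₂) code≡ g₂≡residue =
    cong₂ _,_ (sym (cong proj₁ code≡)) (Fin.toℕ-injective (≡-mod⇒≡ (Fin.toℕ<n _) (Fin.toℕ<n _)
      (mod-24*p⇒mod-N (≡-mod-prime-combine p-prime p∤24 mod-24 mod-p))))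
    where
    mod-24 : + toℕ (proj₂ (difference s P)) ≡ + toℕ g₂ [mod + 24 ]
    mod-24 = begin
      + toℕ (proj₂ (difference s P))  ≈⟨ difference-mod-24 s P ⟩
      + p * + toℕ (subZ 24 b b')      ≡⟨ cong (λ u → + p * + toℕ (proj₂ u)) code≡ ⟨
      + p * + toℕ ((p ℕ.* toℕ g₂) mod 24) ≈⟨ *-congˡ-mod (+ p) (p*-mod-24 (toℕ g₂)) ⟩
      + p * (+ p * + toℕ g₂)          ≈⟨ p*[p*a]≡a _ ⟩
      + toℕ g₂                        ∎
      where open ≡-mod-Reasoning (+ 24)
    mod-p : + toℕ (proj₂ (difference s P)) ≡ + toℕ g₂ [mod + p ]
    mod-p = ≡-mod-trans (residue-difference s P) (≡-mod-sym g₂≡residue)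

  p∤+24 : ¬ (+ p ∣ + 24)
  p∤+24 p∣24 = p∤24 (∣⇒∣ᵤ p∣24)

  p∤residue : ∀ {s P} → s ∈ lowerHalf → Small (Δc P) → ¬ (+ p ∣ residue s P)
  p∤residue {s} {P} s∈ small p∣residue
    with euclidsLemmaℤ p-prime (+ s * + s) (Δc P) (∣-*-cancelˡ-prime p-prime p∤+24 p∣residue)
  ... | inj₁ p∣s² = [ p∤lowerHalf s∈ , p∤lowerHalf s∈ ]′ (euclidsLemmaℤ p-prime (+ s) (+ s) p∣s²)
  ... | inj₂ p∣e  = p∤small small p∣e

  -- Each case reduces to a sum of two squares divisible by p.
  nonsquareRatio-separates : ∀ {s s' e e'} → s ∈ lowerHalf → s' ∈ lowerHalf → Small e → Small e' →
                             NonsquareRatio e e' → ¬ (+ s * + s * e ≡ + s' * + s' * e' [mod + p ])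
  nonsquareRatio-separates {s} {s'} {e} s∈ s'∈ e-small _ (ratio-−1 refl) (∣-difference p∣) =
    p∤lowerHalf s'∈ (sum-of-squares (+ s) (+ s') (∣⇒≡0-mod
      (∣-*-cancelʳ-prime p-prime (p∤small e-small) (subst (+ p ∣_) (factor (+ s) (+ s') e) p∣))))
    where factor : ∀ s s' e → s * s * e - s' * s' * (- e) ≡ (s * s + s' * s') * e
          factor = solve-∀
  nonsquareRatio-separates {s} {s'} {e} s∈ s'∈ e-small _ (ratio-−4 refl) (∣-difference p∣) =
    p∤double-lowerHalf s'∈ (sum-of-squares (+ s) (+ 2 * + s') (∣⇒≡0-mod
      (∣-*-cancelʳ-prime p-prime (p∤small e-small) (subst (+ p ∣_) (factor (+ s) (+ s') e) p∣))))
    where factor : ∀ s s' e → s * s * e - s' * s' * (- (+ 4 * e)) ≡ (s * s + + 2 * s' * (+ 2 * s')) * e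
          factor = solve-∀
  nonsquareRatio-separates {s} {s'} {e' = e'} s∈ s'∈ _ e'-small (ratio-−¼ refl) (∣-difference p∣) =
    p∤lowerHalf s'∈ (sum-of-squares (+ 2 * + s) (+ s') (∣⇒≡0-mod
      (∣-*-cancelʳ-prime p-prime (p∤small e'-small) (subst (+ p ∣_) (factor (+ s) (+ s') e') (∣m⇒∣-m p∣)))))
    where factor : ∀ s s' e' → - (s * s * (- (+ 4 * e')) - s' * s' * e') ≡ (+ 2 * s * (+ 2 * s) + s' * s') * e'
          factor = solve-∀

  residue-separates : ∀ {s s' P P'} → s ∈ lowerHalf → s' ∈ lowerHalf → P ∈ basePairs → P' ∈ basePairs →
                      code P ≡ code P' → residue s P ≡ residue s' P' [mod + p ] → s ≡ s' × P ≡ P'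
  residue-separates {s} {s'} {P} {P'} s∈ s'∈ P∈ P'∈ same-code residue≡ =
    separate (All.lookup (All.lookup same-code⇒nonsquareRatio P∈) P'∈ same-code)
    where
    s²e≡s'²e' : + s * + s * Δc P ≡ + s' * + s' * Δc P' [mod + p ]
    s²e≡s'²e' = *-cancelˡ-mod-prime p-prime p∤+24 residue≡
    separate : P ≡ P' ⊎ NonsquareRatio (Δc P) (Δc P') → s ≡ s' × P ≡ P'
    separate (inj₁ refl) =
      squares-injective s∈ s'∈ (*-cancelʳ-mod-prime p-prime (p∤small (All.lookup Δc-small P∈)) s²e≡s'²e') , refl
    separate (inj₂ ratio) =
      ⊥-elim (nonsquareRatio-separates s∈ s'∈ (All.lookup Δc-small P∈) (All.lookup Δc-small P'∈) ratio s²e≡s'²e')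

  residueℕ : BasePair → ℕ → ℕ
  residueℕ P s = residue s P %ℕ p

  residueℕ≡residue : ∀ P s → + residueℕ P s ≡ residue s P [mod + p ]
  residueℕ≡residue P s = %ℕ-≡-mod (residue s P) p

  residueℕ-positive : ∀ {P s} → P ∈ basePairs → s ∈ lowerHalf → 0 < residueℕ P s
  residueℕ-positive {P} {s} P∈ s∈ = ℕ.n≢0⇒n>0 λ eq → p∤residue {s} {P} s∈ (All.lookup Δc-small P∈)
    (≡0-mod⇒∣ (≡-mod-trans (≡-mod-sym (residueℕ≡residue P s)) (≡⇒≡-mod (cong +_ eq))))

  residueℕ-separates : ∀ {s s' P P'} → s ∈ lowerHalf → s' ∈ lowerHalf → P ∈ basePairs → P' ∈ basePairs →
                       code P ≡ code P' → residueℕ P s ≡ residueℕ P' s' → s ≡ s' × P ≡ P'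
  residueℕ-separates {s} {s'} {P} {P'} s∈ s'∈ P∈ P'∈ same-code eq = residue-separates s∈ s'∈ P∈ P'∈ same-code
    (≡-mod-trans (≡-mod-sym (residueℕ≡residue P s)) (≡-mod-trans (≡⇒≡-mod (cong +_ eq)) (residueℕ≡residue P' s')))

  residues : BasePair → List ℕ
  residues P = map (residueℕ P) lowerHalf

  residues-unique : ∀ {P} → P ∈ basePairs → Unique (residues P)
  residues-unique P∈ = Unique-map⁺ _ (λ s∈ s'∈ eq → proj₁ (residueℕ-separates s∈ s'∈ P∈ P∈ refl eq)) lowerHalf-unique

  ∈-residues⁻ : ∀ {P w} → w ∈ residues P → ∃[ s ] s ∈ lowerHalf × residue s P ≡ + w [mod + p ]
  ∈-residues⁻ {P} w∈ with ∈.∈-map⁻ (residueℕ P) {xs = lowerHalf} w∈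
  ... | s , s∈ , refl = s , s∈ , ≡-mod-sym (residueℕ≡residue P s)

  residues⊆nonzeroResidues : ∀ {P} → P ∈ basePairs → residues P ⊆ nonzeroResidues
  residues⊆nonzeroResidues {P} P∈ w∈ with ∈.∈-map⁻ (residueℕ P) {xs = lowerHalf} w∈
  ... | s , s∈ , refl = ∈-nonzeroResidues⁺ (residueℕ-positive P∈ s∈) (n%ℕd<d (residue s P) p)

  -- Two distinct base pairs with the same code give 2h distinct nonzero residues, i.e. all of them.
  nonzero-residues-covered : ∀ {P P'} → P ∈ basePairs → P' ∈ basePairs → code P ≡ code P' → P ≢ P' →
    ∀ {w} → 0 < w → w < p →
    (∃[ s ] s ∈ lowerHalf × residue s P ≡ + w [mod + p ]) ⊎ (∃[ s ] s ∈ lowerHalf × residue s P' ≡ + w [mod + p ])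
  nonzero-residues-covered {P} {P'} P∈ P'∈ same-code P≢P' 0<w w<p =
    Sum.map (∈-residues⁻ {P}) (∈-residues⁻ {P'}) (∈.∈-++⁻ (residues P) (nonzeroResidues⊆ (∈-nonzeroResidues⁺ 0<w w<p)))
    where
    disjoint : Disjoint (residues P) (residues P')
    disjoint (x∈ , x∈') with ∈.∈-map⁻ (residueℕ P) {xs = lowerHalf} x∈ | ∈.∈-map⁻ (residueℕ P') {xs = lowerHalf} x∈'
    ... | s , s∈ , refl | s' , s'∈ , eq = P≢P' (proj₂ (residueℕ-separates s∈ s'∈ P∈ P'∈ same-code eq))
    both⊆ : residues P ++ residues P' ⊆ nonzeroResidues
    both⊆ x∈ = [ residues⊆nonzeroResidues P∈ , residues⊆nonzeroResidues P'∈ ]′ (∈.∈-++⁻ (residues P) x∈)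
    length-both : length (residues P ++ residues P') ≡ h ℕ.+ h
    length-both = trans (length-++ (residues P)) (cong₂ ℕ._+_ (length-residues {P}) (length-residues {P'}))
      where length-residues : ∀ {Q} → length (residues Q) ≡ h
            length-residues {Q} = trans (length-map (residueℕ Q) lowerHalf) length-lowerHalf
    nonzeroResidues⊆ : nonzeroResidues ⊆ residues P ++ residues P'
    nonzeroResidues⊆ = Unique∧⊆∧length≥⇒⊇ ℕ._≟_
      (Unique.++⁺ (residues-unique P∈) (residues-unique P'∈) disjoint) both⊆
      (ℕ.≤-reflexive (trans length-nonzeroResidues (sym length-both)))

  differences : List (G 4 N)
  differences = cartesianProductWith difference lowerHalf basePairs

  difference-injective : ∀ {s s' P P'} → s ∈ lowerHalf → s' ∈ lowerHalf → P ∈ basePairs → P' ∈ basePairs →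
                         difference s P ≡ difference s' P' → s ≡ s' × P ≡ P'
  difference-injective {s} {s'} {P} {P'} s∈ s'∈ P∈ P'∈ eq = residue-separates s∈ s'∈ P∈ P'∈
    (trans (sym (code-difference s P)) (trans (cong codeOf eq) (code-difference s' P')))
    (≡-mod-trans (≡-mod-sym (residue-difference s P))
      (≡-mod-trans (≡⇒≡-mod (cong (λ g → + toℕ (proj₂ g)) eq)) (residue-difference s' P')))

  differences-unique : Unique differences
  differences-unique = Unique-cartesianProductWith⁺ difference difference-injective lowerHalf-unique basePairs-unique

  differences-outside-leave : ∀ {g} → g ∈ differences → ¬ (p ℕ.∣ toℕ (proj₂ g))
  differences-outside-leave g∈ p∣g₂ with ∈.∈-cartesianProductWith⁻ difference lowerHalf basePairs g∈
  ... | s , P , s∈ , P∈ , refl = p∤residue {s} {P} s∈ (All.lookup Δc-small P∈)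
    (≡0-mod⇒∣ (≡-mod-trans (≡-mod-sym (residue-difference s P)) (∣⇒≡0-mod (∣ᵤ⇒∣ p∣g₂))))

  ∈-differences⁺ : ∀ {s P} g → s ∈ lowerHalf → P ∈ basePairs → code P ≡ codeOf g →
                   residue s P ≡ + (toℕ (proj₂ g) ℕ.% p) [mod + p ] → g ∈ differences
  ∈-differences⁺ {s} {P} g s∈ P∈ code≡ residue≡ =
    subst (_∈ differences) (difference-determined s P g (sym code≡) g₂≡residue)
      (∈.∈-cartesianProductWith⁺ difference s∈ P∈)
    where g₂≡residue = ≡-mod-trans (≡-mod-sym (%-≡-mod (toℕ (proj₂ g)) p)) (≡-mod-sym residue≡)

  outside-leave⇒∈-differences : ∀ g → ¬ (p ℕ.∣ toℕ (proj₂ g)) → g ∈ differences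
  outside-leave⇒∈-differences g p∤g₂ = from-twins (twins (codeOf g))
    where
    w-positive : 0 < toℕ (proj₂ g) ℕ.% p
    w-positive = ℕ.n≢0⇒n>0 (p∤g₂ ∘ ℕ.m%n≡0⇒n∣m (toℕ (proj₂ g)) p)
    from-twins : (∃₂ λ P P' → P ∈ basePairs × P' ∈ basePairs × code P ≡ codeOf g × code P' ≡ codeOf g × P ≢ P') →
                 g ∈ differences
    from-twins (P , P' , P∈ , P'∈ , codeP , codeP' , P≢P') =
      [ (λ (s , s∈ , residue≡) → ∈-differences⁺ g s∈ P∈ codeP residue≡)
      , (λ (s , s∈ , residue≡) → ∈-differences⁺ g s∈ P'∈ codeP' residue≡)
      ]′ (nonzero-residues-covered P∈ P'∈ (trans codeP (sym codeP')) P≢P' w-positive (m%n<n (toℕ (proj₂ g)) p))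

  translates : ℕ → List (List (G 4 N))
  translates s = map (map (point s)) baseBlocks

  development : List (List (G 4 N))
  development = concatMap translates lowerHalf

  ΔFamily-development : ΔFamily 4 N development ≡ differences
  ΔFamily-development = ΔFamily-translates lowerHalf
    where
    ΔFamily-translates : ∀ ss → ΔFamily 4 N (concatMap translates ss) ≡ cartesianProductWith difference ss basePairs
    ΔFamily-translates [] = refl
    ΔFamily-translates (s ∷ ss) = trans (concatMap-++ (ΔB 4 N) (translates s) (concatMap translates ss))
      (cong (map (difference s) basePairs ++_) (ΔFamily-translates ss))

  difference-of-equal≡0 : ∀ s x y → point s x ≡ point s y → + toℕ (proj₂ (difference s (x , y))) ≡ + 0 [mod + N ]
  difference-of-equal≡0 s x y eq = subst (λ g → + toℕ (subZ N (proj₂ (point s x)) (proj₂ g)) ≡ + 0 [mod + N ]) eq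
                                 (subZ-self-≡-mod N (proj₂ (point s x)))

  point-separates : ∀ {s x y} → s ∈ lowerHalf → Small (Δc (x , y)) → point s x ≢ point s y
  point-separates {s} {x} {y} s∈ small eq = p∤residue {s} {x , y} s∈ small (≡0-mod⇒∣ (≡-mod-trans
    (≡-mod-sym (residue-difference s (x , y))) (≡-mod-weakenʳ {+ 24} (mod-N⇒mod-24*p (difference-of-equal≡0 s x y eq)))))

  point-injective-on-blocks : ∀ {s B x y} → s ∈ lowerHalf → B ∈ baseBlocks → x ∈ B → y ∈ B →
                              point s x ≡ point s y → x ≡ y
  point-injective-on-blocks s∈ B∈ x∈ y∈ eq = [ (λ x≡y → x≡y) , (λ small → ⊥-elim (point-separates s∈ small eq)) ]′
    (All.lookup (All.lookup (All.lookup blocks-Δc-small B∈) x∈) y∈)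

  development-blocks : All (λ B → Unique B × length B ∈ 4 ∷ 5 ∷ []) development
  development-blocks = concat⁺ (map⁺ (All.tabulate λ s∈ → map⁺ (All.tabulate (translate-valid s∈))))
    where
    translate-valid : ∀ {s B} → s ∈ lowerHalf → B ∈ baseBlocks →
                      Unique (map (point s) B) × length (map (point s) B) ∈ 4 ∷ 5 ∷ []
    translate-valid {s} {B} s∈ B∈ =
      Unique-map⁺ (point s) (point-injective-on-blocks s∈ B∈) (proj₁ (All.lookup blocks-valid B∈)) ,
      subst (_∈ 4 ∷ 5 ∷ []) (sym (length-map (point s) B)) (proj₂ (All.lookup blocks-valid B∈))

  countSize-++ : ∀ {A : Set} k (xs ys : List (List A)) → countSize k (xs ++ ys) ≡ countSize k xs ℕ.+ countSize k ys
  countSize-++ k xs ys =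
    trans (cong length (filter-++ (λ B → length B ℕ.≟ k) xs ys)) (length-++ (filter (λ B → length B ℕ.≟ k) xs))

  -- six base blocks of each size
  translates-balanced : ∀ s → countSize 4 (translates s) ≡ countSize 5 (translates s)
  translates-balanced s = refl

  development-balanced : countSize 4 development ≡ countSize 5 development
  development-balanced = balanced lowerHalf
    where
    balanced : ∀ ss → countSize 4 (concatMap translates ss) ≡ countSize 5 (concatMap translates ss)
    balanced [] = refl
    balanced (s ∷ ss) = begin
      countSize 4 (translates s ++ concatMap translates ss)               ≡⟨ countSize-++ 4 (translates s) (concatMap translates ss) ⟩
      countSize 4 (translates s) ℕ.+ countSize 4 (concatMap translates ss) ≡⟨ cong₂ ℕ._+_ (translates-balanced s) (balanced ss) ⟩
      countSize 5 (translates s) ℕ.+ countSize 5 (concatMap translates ss) ≡⟨ countSize-++ 5 (translates s) (concatMap translates ss) ⟨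
      countSize 5 (translates s ++ concatMap translates ss)               ∎
      where open ≡-Reasoning

  development-balanced-on : ∀ k k' → k ∈ 4 ∷ 5 ∷ [] → k' ∈ 4 ∷ 5 ∷ [] →
                            countSize k development ≡ countSize k' development
  development-balanced-on _ _ (here refl)         (here refl)         = refl
  development-balanced-on _ _ (here refl)         (there (here refl)) = development-balanced
  development-balanced-on _ _ (there (here refl)) (here refl)         = sym development-balanced
  development-balanced-on _ _ (there (here refl)) (there (here refl)) = refl

  N/24≡p : N ℕ./ 24 ≡ p
  N/24≡p = trans (cong (ℕ._/ 24) (ℕ.*-comm 24 p)) (m*n/n≡m p 24)

  ∉-differences⇔p∣ : ∀ g → (g ∉ differences) ⇔ p ℕ.∣ toℕ (proj₂ g)
  ∉-differences⇔p∣ g = mk⇔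
    (λ g∉ → decidable-stable (p ℕ.∣? toℕ (proj₂ g)) (g∉ ∘ outside-leave⇒∈-differences g))
    (λ p∣g₂ g∈ → differences-outside-leave g∈ p∣g₂)

  development-leave : ∀ (g : G 4 N) →
    (g ∉ ΔFamily 4 N development) ⇔ ((4 ℕ./ 4) ℕ.∣ toℕ (proj₁ g) × (N ℕ./ 24) ℕ.∣ toℕ (proj₂ g))
  development-leave g = subst (λ Δ → (g ∉ Δ) ⇔ ((4 ℕ./ 4) ℕ.∣ toℕ (proj₁ g) × (N ℕ./ 24) ℕ.∣ toℕ (proj₂ g)))
    (sym ΔFamily-development) (mk⇔
    (λ g∉ → ℕ.1∣ _ , subst (ℕ._∣ toℕ (proj₂ g)) (sym N/24≡p) (Equivalence.to (∉-differences⇔p∣ g) g∉))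
    (λ (_ , N/24∣g₂) → Equivalence.from (∉-differences⇔p∣ g) (subst (ℕ._∣ toℕ (proj₂ g)) N/24≡p N/24∣g₂)))

  development-isBDP : IsBDP 4 N 4 24 (4 ∷ 5 ∷ []) development
  development-isBDP = development-blocks
                    , subst Unique (sym ΔFamily-development) differences-unique
                    , development-balanced-on
                    , development-leave

open import Defs using (G; IsBDP)
open import Data.Nat using (ℕ; _*_; _%_; _≥_)
open import Data.Nat.Properties using (m*n≢0)
open import Data.Nat.Primality using (Prime; prime⇒nonZero)
open import Data.List using (List; _∷_; [])
open import Data.Product using (Σ; _,_)
open import Relation.Binary.PropositionalEquality using (_≡_)

lemma2p4 : (p : ℕ) → (pp : Prime p) → p % 4 ≡ 3 → p ≥ 7 →
    Σ (List (List (G 4 (24 * p))))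
      (λ ℬ → IsBDP 4 (24 * p) 4 24 ⦃ _ ⦄ ⦃ m*n≢0 24 p ⦃ _ ⦄ ⦃ prime⇒nonZero pp ⦄ ⦄ (4 ∷ 5 ∷ []) ℬ)
lemma2p4 p pp p%4≡3 p≥7 = development , development-isBDP
  where open Construction p pp p%4≡3 p≥7
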